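{- If $i \ge 1$ is an integer with $C(9i+6) = 1$, then $\sigma_\infty(32i+17) = \sigma_\infty(32i+18)$.
   Context: $T:\mathbb{Z}^+\to\mathbb{Z}^+$ is defined by $T(x) = x/2$ if $x$ is even and $T(x) = (3x+1)/2$ if $x$ is odd; $T^k$ denotes the $k$-fold iterate, $T^0$ the identity. For $x \in \mathbb{Z}^+$, $\sigma_\infty(x)$ is the least $k \ge 0$ with $T^k(x) = 1$, and $\sigma_\infty(x) = \infty$ if no such $k$ exists. The function $C:\mathbb{Z}^+\to\{0,1\}$ is defined recursively by $C(1) = 0$, $C(n) = 1 - C(n-2)$ if $n > 1$ is odd, and $C(n) = 1 - C(n/2)$ if $n$ is even. -}

module Defs where

open import Data.Nat using (ℕ; zero; suc; _+_; _*_; _<_; _≤_; s≤s; z≤n)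
open import Data.Nat.Properties using (≤-refl; m≤n⇒m≤1+n; n≤1+n)
open import Data.Nat.Induction using (<-rec)
open import Data.Nat.Base using (⌊_/2⌋)
open import Data.Nat.Properties using (⌊n/2⌋<n)
open import Data.Bool using (Bool; true; false; if_then_else_)
open import Data.Product using (_×_)
open import Relation.Binary.PropositionalEquality using (_≡_; _≢_)
open import Function.Bundles using (_⇔_)

even? : ℕ → Bool
even? zero = true
even? (suc zero) = false
even? (suc (suc n)) = even? n

T : ℕ → ℕ
T x = if even? x then ⌊ x /2⌋ else ⌊ (3 * x + 1) /2⌋

T^ : ℕ → ℕ → ℕ
T^ zero x = x
T^ (suc k) x = T (T^ k x)

-- k is the least index with T^k(x) = 1, i.e. σ∞(x) = k
StopsAt : ℕ → ℕ → Set
StopsAt x k = (T^ k x ≡ 1) × (∀ j → j < k → T^ j x ≢ 1)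

-- σ∞(x) = σ∞(y) as values in ℕ ∪ {∞}: for every finite k,
-- σ∞(x) = k iff σ∞(y) = k (so both are ∞ or both equal the same k).
SameStoppingTime : ℕ → ℕ → Set
SameStoppingTime x y = ∀ k → StopsAt x k ⇔ StopsAt y k

-- C : ℤ⁺ → {0,1}; C(1)=0, C(n)=1-C(n-2) for odd n>1, C(n)=1-C(n/2) for even n.
-- Defined on ℕ by strong recursion; the value at 0 (outside the domain) is set to 0.
flip : ℕ → ℕ
flip zero = 1
flip (suc _) = 0

C : ℕ → ℕ
C = <-rec (λ _ → ℕ) step
  where
  step : ∀ n → (∀ {m} → m < n → ℕ) → ℕ
  step zero rec = 0
  step (suc zero) rec = 0
  step (suc (suc n)) rec with even? n
  ... | true  = flip (rec {⌊ suc (suc n) /2⌋} (⌊n/2⌋<n (suc n)))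
  ... | false = flip (rec {n} (n≤1+n (suc n)))

-- Following T, 32i+17 and 32i+18 reach 24i+13 and 24i+14, then 18i+10 and 18i+11, then
-- M = 9i+5 and 3M+2, so it suffices that M and 3M+2 coalesce.  That holds whenever
-- C(M+1) = 1 and M ≥ 3, by induction on the 2-adic valuation of M+1.  If M = 2a−1 is odd,
-- one step sends M to M′ = 3a−1 and 3M+2 to 3M′+2; now M′+1 = 3a has smaller valuation and
-- C(3a) = 1 − C(a) = C(2a) = 1.  If M is even, C(M+1) = 1 forces M = 4t+2, since C(2w+1) is
-- the parity of w, and then M and 3M+2 both reach 3t+2 in two steps.

{-# OPTIONS --safe #-}
module Submission where

open import Defs
open import Data.Nat using (ℕ; zero; suc; _+_; _*_; _^_; _≤_; _<_; _<′_; ⌊_/2⌋; s≤s; z≤n; <′-base; <′-step)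
open import Data.Nat.Properties
  using ( ⌊n/2⌋<n; n≤1+n; <⇒<′; n≡⌊n+n/2⌋; +-suc; +-identityʳ; +-comm; *-suc; *-identityˡ; *-assoc
        ; m<m+n; suc-injective; 0≢1+n)
open import Data.Nat.Induction using (<-rec; <′-wellFounded; <′-wellFounded′)
open import Data.Nat.Tactic.RingSolver using (solve)
open import Data.Bool using (true; false)
open import Data.List using ([]; _∷_)
open import Data.Product using (∃₂; _,_)
open import Data.Empty using (⊥-elim)
open import Relation.Binary.PropositionalEquality
  using (_≡_; _≢_; refl; sym; trans; cong; subst; subst₂; module ≡-Reasoning)
open import Function.Bundles using (mk⇔)

open ≡-Reasoning

even?-2* : ∀ a → even? (2 * a) ≡ true
even?-2* zero    = refl
even?-2* (suc a) rewrite +-suc a (a + 0) = even?-2* a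

even?-1+2* : ∀ a → even? (1 + 2 * a) ≡ false
even?-1+2* zero    = refl
even?-1+2* (suc a) rewrite +-suc a (a + 0) = even?-1+2* a

2*≢1 : ∀ a → 2 * a ≢ 1
2*≢1 a 2a≡1 with trans (sym (even?-2* a)) (cong even? 2a≡1)
... | ()

⌊2*a/2⌋≡a : ∀ a → ⌊ 2 * a /2⌋ ≡ a
⌊2*a/2⌋≡a a rewrite +-identityʳ a = sym (n≡⌊n+n/2⌋ a)

data Parity : ℕ → Set where
  even : ∀ t → Parity (2 * t)
  odd  : ∀ t → Parity (1 + 2 * t)

parity : ∀ n → Parity n
parity zero = even 0
parity (suc n) with parity n
... | even t = odd t
... | odd t  = subst Parity (*-suc 2 t) (even (suc t))

2^k*odd : ∀ n → 1 ≤ n → ∃₂ λ k w → n ≡ 2 ^ k * (1 + 2 * w)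
2^k*odd = <-rec (λ n → 1 ≤ n → ∃₂ λ k w → n ≡ 2 ^ k * (1 + 2 * w)) go
  where
  go : ∀ n → (∀ {m} → m < n → 1 ≤ m → ∃₂ λ k w → m ≡ 2 ^ k * (1 + 2 * w)) →
       1 ≤ n → ∃₂ λ k w → n ≡ 2 ^ k * (1 + 2 * w)
  go n rec 1≤n with parity n
  go .(2 * 0)     rec ()  | even zero
  go .(2 * suc t) rec _   | even (suc t) with rec (m<m+n (suc t) (s≤s z≤n)) (s≤s z≤n)
  ... | k , w , t≡ = suc k , w , trans (cong (2 *_) t≡) (sym (*-assoc 2 (2 ^ k) (1 + 2 * w)))
  go .(1 + 2 * w) rec _   | odd w = 0 , w , sym (*-identityˡ (1 + 2 * w))

T-even : ∀ x a → x ≡ 2 * a → T x ≡ a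
T-even _ a refl with even? (2 * a) | even?-2* a
... | true | refl = ⌊2*a/2⌋≡a a

T-odd : ∀ x a → x ≡ 1 + 2 * a → T x ≡ 2 + 3 * a
T-odd _ a refl with even? (1 + 2 * a) | even?-1+2* a
... | false | refl = begin
  ⌊ (3 * (1 + 2 * a) + 1) /2⌋ ≡⟨ cong ⌊_/2⌋ (solve (a ∷ [])) ⟩
  ⌊ 2 * (2 + 3 * a) /2⌋       ≡⟨ ⌊2*a/2⌋≡a (2 + 3 * a) ⟩
  2 + 3 * a                   ∎

data Coalesce : ℕ → ℕ → Set where
  meet : ∀ x → Coalesce x x
  step : ∀ {x y x′ y′} → x ≢ 1 → y ≢ 1 → T x ≡ x′ → T y ≡ y′ → Coalesce x′ y′ → Coalesce x y

Coalesce-sym : ∀ {x y} → Coalesce x y → Coalesce y x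
Coalesce-sym (meet x)             = meet x
Coalesce-sym (step x≢1 y≢1 p q c) = step y≢1 x≢1 q p (Coalesce-sym c)

T^-suc : ∀ k x → T^ (suc k) x ≡ T^ k (T x)
T^-suc zero    x = refl
T^-suc (suc k) x = cong T (T^-suc k x)

StopsAt-T : ∀ {x k} → StopsAt x (suc k) → StopsAt (T x) k
StopsAt-T {x} {k} (hit , ¬earlier) =
  trans (sym (T^-suc k x)) hit ,
  λ j j<k T^j≡1 → ¬earlier (suc j) (s≤s j<k) (trans (T^-suc j x) T^j≡1)

StopsAt-T⁻¹ : ∀ {x k} → x ≢ 1 → StopsAt (T x) k → StopsAt x (suc k)
StopsAt-T⁻¹ {x} {k} x≢1 (hit , ¬earlier) = trans (T^-suc k x) hit , ¬earlier′
  where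
  ¬earlier′ : ∀ j → j < suc k → T^ j x ≢ 1
  ¬earlier′ zero    _         = x≢1
  ¬earlier′ (suc j) (s≤s j<k) = λ T^j≡1 → ¬earlier j j<k (trans (sym (T^-suc j x)) T^j≡1)

Coalesce⇒StopsAt : ∀ {x y} → Coalesce x y → ∀ k → StopsAt x k → StopsAt y k
Coalesce⇒StopsAt (meet x)                 k       s         = s
Coalesce⇒StopsAt (step x≢1 _ refl refl _) zero    (hit , _) = ⊥-elim (x≢1 hit)
Coalesce⇒StopsAt (step _ y≢1 refl refl c) (suc k) s         =
  StopsAt-T⁻¹ y≢1 (Coalesce⇒StopsAt c k (StopsAt-T s))

Coalesce⇒SameStoppingTime : ∀ {x y} → Coalesce x y → SameStoppingTime x y
Coalesce⇒SameStoppingTime c k = mk⇔ (Coalesce⇒StopsAt c k) (Coalesce⇒StopsAt (Coalesce-sym c) k)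

Coalesce-1+4* : ∀ j → Coalesce (1 + 3 * j) (2 + 3 * j) → Coalesce (1 + 4 * j) (2 + 4 * j)
Coalesce-1+4* zero    c = c
Coalesce-1+4* (suc j) c =
  step (λ ()) (λ ())
    (T-odd (1 + 4 * suc j) (2 * suc j) (solve (j ∷ [])))
    (T-even (2 + 4 * suc j) (1 + 2 * suc j) (solve (j ∷ [])))
  (step (λ ()) (λ ())
    (T-even (2 + 3 * (2 * suc j)) (1 + 3 * suc j) (solve (j ∷ [])))
    (T-odd (1 + 2 * suc j) (suc j) refl)
  c)

Coalesce-2* : ∀ M → 1 ≤ M → Coalesce M (2 + 3 * M) → Coalesce (2 * M) (1 + 2 * M)
Coalesce-2* zero      ()
Coalesce-2* M@(suc _) _ c = step (2*≢1 M) (λ ()) (T-even (2 * M) M refl) (T-odd (1 + 2 * M) M refl) c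

Coalesce-2+3*-of-2*odd : ∀ t → 3 ≤ 2 * (1 + 2 * t) →
  Coalesce (2 * (1 + 2 * t)) (2 + 3 * (2 * (1 + 2 * t)))
Coalesce-2+3*-of-2*odd zero    (s≤s (s≤s ()))
Coalesce-2+3*-of-2*odd (suc t) _ =
  step (2*≢1 (1 + 2 * suc t)) (λ ())
    (T-even (2 * (1 + 2 * suc t)) (1 + 2 * suc t) refl)
    (T-even (2 + 3 * (2 * (1 + 2 * suc t))) (2 * (2 + 3 * suc t)) (solve (t ∷ [])))
  (step (λ ()) (2*≢1 (2 + 3 * suc t))
    (T-odd (1 + 2 * suc t) (suc t) refl)
    (T-even (2 * (2 + 3 * suc t)) (2 + 3 * suc t) refl)
  (meet (2 + 3 * suc t)))

Coalesce-2+3*-of-odd : ∀ h → 3 ≤ 1 + 2 * h →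
  Coalesce (2 + 3 * h) (2 + 3 * (2 + 3 * h)) → Coalesce (1 + 2 * h) (2 + 3 * (1 + 2 * h))
Coalesce-2+3*-of-odd zero    (s≤s ())
Coalesce-2+3*-of-odd (suc h) _ c =
  step (λ ()) (λ ())
    (T-odd (1 + 2 * suc h) (suc h) refl)
    (T-odd (2 + 3 * (1 + 2 * suc h)) (2 + 3 * suc h) (solve (h ∷ [])))
  c

-- C is defined by well-founded recursion, and it unfolds definitionally once the
-- accessibility proof handed to the recursive call is seen to be the canonical one.
<′-wellFounded′-canonical : ∀ {m n} (m<n : m <′ n) → <′-wellFounded′ n m<n ≡ <′-wellFounded m
<′-wellFounded′-canonical <′-base        = refl
<′-wellFounded′-canonical (<′-step m<n) = <′-wellFounded′-canonical m<n

C-even : ∀ n → even? n ≡ true → C (2 + n) ≡ flip (C (1 + ⌊ n /2⌋))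
C-even n n-even with even? n | n-even
... | true | refl rewrite <′-wellFounded′-canonical (<⇒<′ (⌊n/2⌋<n (suc n))) = refl

C-odd : ∀ n → even? n ≡ false → C (2 + n) ≡ flip (C n)
C-odd n n-odd with even? n | n-odd
... | false | refl rewrite <′-wellFounded′-canonical (<⇒<′ (n≤1+n (suc n))) = refl

C-2* : ∀ a → C (2 * suc a) ≡ flip (C (suc a))
C-2* a = begin
  C (2 * suc a)              ≡⟨ cong C (*-suc 2 a) ⟩
  C (2 + 2 * a)              ≡⟨ C-even (2 * a) (even?-2* a) ⟩
  flip (C (1 + ⌊ 2 * a /2⌋)) ≡⟨ cong (λ b → flip (C (suc b))) (⌊2*a/2⌋≡a a) ⟩
  flip (C (suc a))           ∎

C-1+2*-even : ∀ t → C (1 + 2 * (2 * t)) ≡ 0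
C-1+2*-odd  : ∀ t → C (1 + 2 * (1 + 2 * t)) ≡ 1

C-1+2*-even zero    = refl
C-1+2*-even (suc t) = begin
  C (1 + 2 * (2 * suc t))        ≡⟨ cong C arith ⟩
  C (3 + 2 * (1 + 2 * t))        ≡⟨ C-odd (1 + 2 * (1 + 2 * t)) (even?-1+2* (1 + 2 * t)) ⟩
  flip (C (1 + 2 * (1 + 2 * t))) ≡⟨ cong flip (C-1+2*-odd t) ⟩
  0                              ∎
  where
  arith : 1 + 2 * (2 * suc t) ≡ 3 + 2 * (1 + 2 * t)
  arith = solve (t ∷ [])

C-1+2*-odd t = begin
  C (1 + 2 * (1 + 2 * t))        ≡⟨ cong C arith ⟩
  C (3 + 2 * (2 * t))            ≡⟨ C-odd (1 + 2 * (2 * t)) (even?-1+2* (2 * t)) ⟩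
  flip (C (1 + 2 * (2 * t)))     ≡⟨ cong flip (C-1+2*-even t) ⟩
  1                              ∎
  where
  arith : 1 + 2 * (1 + 2 * t) ≡ 3 + 2 * (2 * t)
  arith = solve (t ∷ [])

C-3*-odd : ∀ w → C (3 * (1 + 2 * w)) ≡ flip (C (1 + 2 * w))
C-3*-odd w with parity w
... | even t = begin
  C (3 * (1 + 2 * (2 * t)))      ≡⟨ cong C arith ⟩
  C (1 + 2 * (1 + 2 * (3 * t)))  ≡⟨ C-1+2*-odd (3 * t) ⟩
  1                              ≡⟨ cong flip (sym (C-1+2*-even t)) ⟩
  flip (C (1 + 2 * (2 * t)))     ∎
  where
  arith : 3 * (1 + 2 * (2 * t)) ≡ 1 + 2 * (1 + 2 * (3 * t))
  arith = solve (t ∷ [])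
... | odd t = begin
  C (3 * (1 + 2 * (1 + 2 * t)))  ≡⟨ cong C arith ⟩
  C (1 + 2 * (2 * (2 + 3 * t)))  ≡⟨ C-1+2*-even (2 + 3 * t) ⟩
  0                              ≡⟨ cong flip (sym (C-1+2*-odd t)) ⟩
  flip (C (1 + 2 * (1 + 2 * t))) ∎
  where
  arith : 3 * (1 + 2 * (1 + 2 * t)) ≡ 1 + 2 * (2 * (2 + 3 * t))
  arith = solve (t ∷ [])

C-3*-2* : ∀ a → C (3 * suc a) ≡ flip (C (suc a)) → C (3 * (2 * suc a)) ≡ flip (C (2 * suc a))
C-3*-2* a C-3*a = begin
  C (3 * (2 * suc a))     ≡⟨ cong C arith ⟩
  C (2 * suc (2 + 3 * a)) ≡⟨ C-2* (2 + 3 * a) ⟩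
  flip (C (3 + 3 * a))    ≡⟨ cong (λ n → flip (C n)) (sym (*-suc 3 a)) ⟩
  flip (C (3 * suc a))    ≡⟨ cong flip C-3*a ⟩
  flip (flip (C (suc a))) ≡⟨ cong flip (sym (C-2* a)) ⟩
  flip (C (2 * suc a))    ∎
  where
  arith : 3 * (2 * suc a) ≡ 2 * suc (2 + 3 * a)
  arith = solve (a ∷ [])

C-3* : ∀ a → 1 ≤ a → C (3 * a) ≡ flip (C a)
C-3* = <-rec (λ a → 1 ≤ a → C (3 * a) ≡ flip (C a)) go
  where
  go : ∀ a → (∀ {b} → b < a → 1 ≤ b → C (3 * b) ≡ flip (C b)) → 1 ≤ a → C (3 * a) ≡ flip (C a)
  go a rec 1≤a with parity a
  go .(2 * 0)     rec () | even zero
  go .(2 * suc t) rec _  | even (suc t) = C-3*-2* t (rec (m<m+n (suc t) (s≤s z≤n)) (s≤s z≤n))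
  go .(1 + 2 * w) rec _  | odd w        = C-3*-odd w

-- The bound 3 ≤ M excludes M = 1 and M = 2, which stop before 5 and 8 do.
CoalescesWithTriple : ℕ → Set
CoalescesWithTriple n = ∀ M → suc M ≡ n → 3 ≤ M → C n ≡ 1 → Coalesce M (2 + 3 * M)

coalescesWithTriple-odd : ∀ w → CoalescesWithTriple (1 + 2 * w)
coalescesWithTriple-odd w .(2 * w) refl 3≤M C≡1 with parity w
... | even t = ⊥-elim (0≢1+n (trans (sym (C-1+2*-even t)) C≡1))
... | odd t  = Coalesce-2+3*-of-2*odd t 3≤M

coalescesWithTriple-2* : ∀ a → CoalescesWithTriple (3 * a) → CoalescesWithTriple (2 * a)
coalescesWithTriple-2* zero            _   M  ()
coalescesWithTriple-2* (suc zero)      _   .1 refl (s≤s ())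
coalescesWithTriple-2* (suc h@(suc _)) ih₃ M  1+M≡2a 3≤M C≡1
  with suc-injective (trans 1+M≡2a (*-suc 2 h))
... | refl =
  Coalesce-2+3*-of-odd h 3≤M (ih₃ (2 + 3 * h) (sym (*-suc 3 h)) (s≤s (s≤s (s≤s z≤n))) C[3a]≡1)
  where
  C[3a]≡1 : C (3 * suc h) ≡ 1
  C[3a]≡1 = trans (C-3* (suc h) (s≤s z≤n)) (trans (sym (C-2* h)) C≡1)

coalescesWithTriple-2^k*odd : ∀ k w → CoalescesWithTriple (2 ^ k * (1 + 2 * w))
coalescesWithTriple-2^k*odd zero    w =
  subst CoalescesWithTriple (sym (*-identityˡ (1 + 2 * w))) (coalescesWithTriple-odd w)
coalescesWithTriple-2^k*odd (suc k) w =
  subst CoalescesWithTriple (sym (*-assoc 2 (2 ^ k) (1 + 2 * w)))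
    (coalescesWithTriple-2* (2 ^ k * (1 + 2 * w))
      (subst CoalescesWithTriple (sym (triple (2 ^ k))) (coalescesWithTriple-2^k*odd k (1 + 3 * w))))
  where
  triple : ∀ p → 3 * (p * (1 + 2 * w)) ≡ p * (1 + 2 * (1 + 3 * w))
  triple p = solve (p ∷ w ∷ [])

coalescesWithTriple : ∀ n → 1 ≤ n → CoalescesWithTriple n
coalescesWithTriple n 1≤n with 2^k*odd n 1≤n
... | k , w , refl = coalescesWithTriple-2^k*odd k w

corollary5p8 : ∀ (i : ℕ) → 1 ≤ i → C (9 * i + 6) ≡ 1 →
    SameStoppingTime (32 * i + 17) (32 * i + 18)
corollary5p8 i _ C[9i+6]≡1 =
  subst₂ SameStoppingTime 1+4j≡32i+17 2+4j≡32i+18 (Coalesce⇒SameStoppingTime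
    (Coalesce-1+4* (4 + 8 * i) (adjacent 1+4j≡1+3j
      (Coalesce-1+4* (3 + 6 * i) (adjacent 2M≡1+3j
        (Coalesce-2* M (s≤s z≤n) M~2+3M))))))
  where
  M : ℕ
  M = 5 + 9 * i

  M~2+3M : Coalesce M (2 + 3 * M)
  M~2+3M = coalescesWithTriple (6 + 9 * i) (s≤s z≤n) M refl (s≤s (s≤s (s≤s z≤n)))
             (trans (cong C (+-comm 6 (9 * i))) C[9i+6]≡1)

  adjacent : ∀ {m n} → m ≡ n → Coalesce m (suc m) → Coalesce n (suc n)
  adjacent = subst (λ n → Coalesce n (suc n))

  2M≡1+3j : 2 * (5 + 9 * i) ≡ 1 + 3 * (3 + 6 * i)
  2M≡1+3j = solve (i ∷ [])
  1+4j≡1+3j : 1 + 4 * (3 + 6 * i) ≡ 1 + 3 * (4 + 8 * i)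
  1+4j≡1+3j = solve (i ∷ [])
  1+4j≡32i+17 : 1 + 4 * (4 + 8 * i) ≡ 32 * i + 17
  1+4j≡32i+17 = solve (i ∷ [])
  2+4j≡32i+18 : 2 + 4 * (4 + 8 * i) ≡ 32 * i + 18
  2+4j≡32i+18 = solve (i ∷ [])
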